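{- Let $G$ be the bipartite graph with bipartition classes $\{v_1,\dots,v_6\}$ and $\{v_7,\dots,v_{12}\}$ and edge set $\{v_1v_7,v_1v_8,v_1v_9,v_1v_{12},v_2v_7,v_2v_8,v_2v_9,v_3v_7,v_3v_8,v_3v_9,v_4v_9,v_4v_{10},v_4v_{11},v_5v_{10},v_5v_{11},v_5v_{12},v_6v_{10},v_6v_{11},v_6v_{12}\}$. Then $\dim_{\mathbb{Z}/2}\bigl(\mathrm{Z}_1(G;\mathbb{Z}/2)/\langle\mathcal{H}(G)\rangle_{\mathbb{Z}/2}\bigr)\geq1$.
   Context: $\mathrm{Z}_1(G;\mathbb{Z}/2)$ is the cycle space of $G$ over $\mathbb{Z}/2$; $\mathcal{H}(G)$ is the set of Hamilton circuits of $G$ (identified with their edge sets) and $\langle\mathcal{H}(G)\rangle_{\mathbb{Z}/2}$ their span. -}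

module Defs where

open import Data.Nat using (ℕ; suc)
open import Data.Nat.DivMod using (_%_; m%n<n)
open import Data.Fin using (Fin; toℕ; fromℕ<; #_)
open import Data.Fin.Properties using ()
open import Data.Bool using (Bool; true; false; _xor_; _∧_; if_then_else_)
open import Data.List using (List; []; _∷_; foldr; map; allFin)
open import Data.Product using (Σ; _×_; _,_; proj₁)
open import Data.Sum using (_⊎_)
open import Relation.Binary.PropositionalEquality using (_≡_)
open import Relation.Nullary using (¬_; does)
open import Function.Definitions using (Injective)
open import Data.Fin using (_≟_)

-- Vertices v₁ … v₁₂ are represented by Fin 12 (v_k ↦ k - 1).
Vertex : Set
Vertex = Fin 12

Edge : Set
Edge = Fin 19

ends : Edge → Vertex × Vertex
ends e = go (toℕ e)
  where
  v : ℕ → Vertex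
  v k = fromℕ< (m%n<n k 12)
  pair : ℕ → ℕ → Vertex × Vertex
  pair a b = v (a ∸' 1) , v (b ∸' 1)
    where
    _∸'_ : ℕ → ℕ → ℕ
    ℕ.zero ∸' _ = ℕ.zero
    suc n ∸' ℕ.zero = suc n
    suc n ∸' suc m = n ∸' m
  go : ℕ → Vertex × Vertex
  go 0  = pair 1 7
  go 1  = pair 1 8
  go 2  = pair 1 9
  go 3  = pair 1 12
  go 4  = pair 2 7
  go 5  = pair 2 8
  go 6  = pair 2 9
  go 7  = pair 3 7
  go 8  = pair 3 8
  go 9  = pair 3 9
  go 10 = pair 4 9
  go 11 = pair 4 10
  go 12 = pair 4 11
  go 13 = pair 5 10
  go 14 = pair 5 11
  go 15 = pair 5 12
  go 16 = pair 6 10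
  go 17 = pair 6 11
  go _  = pair 6 12

src tgt : Edge → Vertex
src e = proj₁ (ends e)
tgt e = Data.Product.proj₂ (ends e)

Joins : Edge → Vertex → Vertex → Set
Joins e u w = (src e ≡ u × tgt e ≡ w) ⊎ (src e ≡ w × tgt e ≡ u)

-- 1-chains over ℤ/2 (ℤ/2 represented by Bool with xor as addition):
-- edge sets as characteristic vectors
Chain : Set
Chain = Edge → Bool

sumE : (Edge → Bool) → Bool
sumE f = foldr _xor_ false (map f (allFin 19))

incident : Vertex → Edge → Bool
incident v e = does (src e ≟ v) Data.Bool.∨ does (tgt e ≟ v)

boundary : Chain → Vertex → Bool
boundary z v = sumE (λ e → z e ∧ incident v e)

InCycleSpace : Chain → Set
InCycleSpace z = ∀ v → boundary z v ≡ false

next : Fin 12 → Fin 12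
next i = fromℕ< (m%n<n (suc (toℕ i)) 12)

-- h is (the edge set of) a Hamilton circuit of G: there is a cyclic
-- ordering c of all 12 vertices (injective, hence bijective) such that
-- consecutive vertices are adjacent, and h consists exactly of the edges
-- joining consecutive vertices.
IsHamiltonCircuit : Chain → Set
IsHamiltonCircuit h =
  Σ (Fin 12 → Vertex) λ c →
    Injective _≡_ _≡_ c
    × (∀ i → Σ Edge λ e → Joins e (c i) (c (next i)))
    × (∀ e → h e ≡ true → Σ (Fin 12) λ i → Joins e (c i) (c (next i)))
    × (∀ e i → Joins e (c i) (c (next i)) → h e ≡ true)

HamiltonCircuit : Set
HamiltonCircuit = Σ Chain IsHamiltonCircuit

sumH : List HamiltonCircuit → Chain
sumH [] e = false
sumH (h ∷ hs) e = proj₁ h e xor sumH hs e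

InHamSpan : Chain → Set
InHamSpan z = Σ (List HamiltonCircuit) λ hs → ∀ e → sumH hs e ≡ z e

-- dim (Z₁ / ⟨𝓗⟩) ≥ 1, i.e. the quotient is nonzero:
-- some cycle is not in the span of the Hamilton circuits
QuotientDimAtLeastOne : Set
QuotientDimAtLeastOne = Σ Chain λ z → InCycleSpace z × ¬ InHamSpan z

-- G consists of the blocks L = {v₁,v₂,v₃,v₇,v₈,v₉} and R = {v₄,v₅,v₆,v₁₀,v₁₁,v₁₂},
-- joined only by the edges v₁v₁₂ and v₄v₉, so every edge between L and R meets v₁ or v₉.
-- Cutting a Hamilton circuit through v₁v₉ open at that edge gives a Hamilton path
-- starting with v₁ and v₉; none of its later steps meets v₁ or v₉, so none crosses
-- between L and R, and all ten remaining vertices would lie in one block.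
-- Hence no Hamilton circuit uses v₁v₉: every element of their span vanishes on v₁v₉,
-- while the 4-cycle v₁v₇v₂v₉ does not.
module Submission where

open import Defs
open import Data.Bool using (Bool; true; false; _xor_; _∨_)
import Data.Bool.Properties as Bool
open import Data.Empty using (⊥-elim)
open import Data.Fin using (Fin; #_; _≟_; punchOut)
open import Data.Fin.Properties using (all?; any?; punchOut-injective; <⇒notInjective)
open import Data.List using ([]; _∷_)
open import Data.Nat using (ℕ; zero; suc; _+_; _<_; s≤s; z≤n)
import Data.Nat.Properties as ℕ
open import Data.Product using (Σ; ∃-syntax; _×_; _,_; proj₁; proj₂)
open import Data.Sum using (_⊎_; inj₁; inj₂; swap)
import Data.Sum as Sum
open import Data.Unit using (tt)
open import Data.Vec using (lookup; []; _∷_)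
open import Function using (_∘_; flip; case_of_)
open import Function.Definitions using (Injective)
open import Relation.Binary.PropositionalEquality
open import Relation.Nullary using (¬_; yes; no; does; contradiction)
open import Relation.Nullary.Decidable using (toWitness; ¬?; _→-dec_; _⊎-dec_)

injective⇒surjective : ∀ {n} {f : Fin n → Fin n} → Injective _≡_ _≡_ f → ∀ y → ∃[ x ] f x ≡ y
injective⇒surjective {zero}  _   ()
injective⇒surjective {suc n} {f} f-inj y with any? (λ x → f x ≟ y)
... | yes found = found
... | no missed = ⊥-elim (<⇒notInjective (ℕ.n<1+n n) punchedOut-injective)
  where
  y≢f : ∀ x → y ≢ f x
  y≢f x y≡fx = missed (x , sym y≡fx)

  punchedOut-injective : Injective _≡_ _≡_ (λ x → punchOut (y≢f x))
  punchedOut-injective {x} {x′} = f-inj ∘ punchOut-injective (y≢f x) (y≢f x′)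

OneOf : ∀ {V : Set} → V → V → V → Set
OneOf a b v = v ≡ a ⊎ v ≡ b

record IsHamiltonPath {V : Set} (Adj : V → V → Set) (n : ℕ) (path : ℕ → V) : Set where
  field
    adjacent  : ∀ {k} → suc k < n → Adj (path k) (path (suc k))
    injective : ∀ {k l} → k < n → l < n → path k ≡ path l → k ≡ l
    covers    : ∀ v → ∃[ k ] k < n × path k ≡ v

module Cut {V : Set} (Adj : V → V → Set) (side : V → Bool) where

  CoveredBy : V → V → Set
  CoveredBy a b = ∀ {u w} → Adj u w → side u ≢ side w → OneOf a b u ⊎ OneOf a b w

  module _ {n path} (ham : IsHamiltonPath Adj n path) {a b} (cover : CoveredBy a b)
           (start : (a ≡ path 0 × b ≡ path 1) ⊎ (a ≡ path 1 × b ≡ path 0)) where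
    open IsHamiltonPath ham

    oneOf-start : ∀ {v} → OneOf a b v → OneOf (path 0) (path 1) v
    oneOf-start v∈ = case start of λ where
      (inj₁ (a≡p₀ , b≡p₁)) → Sum.map (flip trans a≡p₀) (flip trans b≡p₁) v∈
      (inj₂ (a≡p₁ , b≡p₀)) → swap (Sum.map (flip trans a≡p₁) (flip trans b≡p₀) v∈)

    late-∉-cover : ∀ {j} → 2 + j < n → ¬ OneOf a b (path (2 + j))
    late-∉-cover 2+j<n v∈ with oneOf-start v∈
    ... | inj₁ p≡p₀ with () ← injective 2+j<n (ℕ.<-≤-trans (s≤s z≤n) 2+j<n) p≡p₀
    ... | inj₂ p≡p₁ with () ← injective 2+j<n (ℕ.<-≤-trans (s≤s (s≤s z≤n)) 2+j<n) p≡p₁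

    no-late-crossing : ∀ {j} → 3 + j < n → side (path (2 + j)) ≡ side (path (3 + j))
    no-late-crossing {j} 3+j<n with side (path (2 + j)) Bool.≟ side (path (3 + j))
    ... | yes same = same
    ... | no crossing with cover (adjacent 3+j<n) crossing
    ... | inj₁ from∈ = contradiction from∈ (late-∉-cover (ℕ.<-trans (ℕ.n<1+n _) 3+j<n))
    ... | inj₂ to∈ = contradiction to∈ (late-∉-cover 3+j<n)

    side-constant : ∀ j → 2 + j < n → side (path (2 + j)) ≡ side (path 2)
    side-constant zero    _     = refl
    side-constant (suc j) 3+j<n =
      trans (sym (no-late-crossing 3+j<n)) (side-constant j (ℕ.<-trans (ℕ.n<1+n _) 3+j<n))

    path₀∈cover : OneOf a b (path 0)
    path₀∈cover = Sum.map (sym ∘ proj₁) (sym ∘ proj₂) start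

    path₁∈cover : OneOf a b (path 1)
    path₁∈cover = swap (Sum.map (sym ∘ proj₂) (sym ∘ proj₁) start)

    ∉-cover⇒same-side : ∀ {v} → ¬ OneOf a b v → side v ≡ side (path 2)
    ∉-cover⇒same-side {v} v∉ with covers v
    ... | 0           , _     , refl = contradiction path₀∈cover v∉
    ... | 1           , _     , refl = contradiction path₁∈cover v∉
    ... | suc (suc j) , 2+j<n , refl = side-constant j 2+j<n

v₁ v₂ v₉ v₁₂ : Vertex
v₁  = # 0
v₂  = # 1
v₉  = # 8
v₁₂ = # 11

v₁v₉ : Edge
v₁v₉ = # 2

Adjacent : Vertex → Vertex → Set
Adjacent u w = ∃[ e ] Joins e u w

inL : Vertex → Bool
inL = lookup (true ∷ true ∷ true ∷ false ∷ false ∷ false ∷ true ∷ true ∷ true ∷ false ∷ false ∷ false ∷ [])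

open Cut Adjacent inL

crossing-edge-meets-v₁v₉ : ∀ e → inL (src e) ≢ inL (tgt e) → OneOf v₁ v₉ (src e) ⊎ OneOf v₁ v₉ (tgt e)
crossing-edge-meets-v₁v₉ = toWitness {a? = all? λ e →
  ¬? (inL (src e) Bool.≟ inL (tgt e)) →-dec
  ((src e ≟ v₁ ⊎-dec src e ≟ v₉) ⊎-dec (tgt e ≟ v₁ ⊎-dec tgt e ≟ v₉))} tt

cut-coveredBy-v₁v₉ : CoveredBy v₁ v₉
cut-coveredBy-v₁v₉ (e , inj₁ (refl , refl)) = crossing-edge-meets-v₁v₉ e
cut-coveredBy-v₁v₉ (e , inj₂ (refl , refl)) = swap ∘ crossing-edge-meets-v₁v₉ e ∘ (_∘ sym)

advance : ℕ → Fin 12 → Fin 12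
advance zero    i = i
advance (suc k) i = next (advance k i)

-- Opaque so that with-abstractions never unfold the decision procedures.
opaque
  advance-injective : ∀ i {k} → k < 12 → ∀ {l} → l < 12 → advance k i ≡ advance l i → k ≡ l
  advance-injective = toWitness {a? = all? λ i →
    ℕ.allUpTo? (λ k → ℕ.allUpTo? (λ l → advance k i ≟ advance l i →-dec k ℕ.≟ l) 12) 12} tt

  advance-surjective : ∀ i j → ∃[ k ] k < 12 × advance k i ≡ j
  advance-surjective = toWitness {a? = all? λ i → all? λ j → ℕ.anyUpTo? (λ k → advance k i ≟ j) 12} tt

walkFrom : ∀ {h} → IsHamiltonCircuit h → Fin 12 → ℕ → Vertex
walkFrom (c , _) i k = c (advance k i)

walkFrom-isHamiltonPath : ∀ {h} (H : IsHamiltonCircuit h) i → IsHamiltonPath Adjacent 12 (walkFrom H i)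
walkFrom-isHamiltonPath (c , c-inj , steps , _) i = record
  { adjacent  = λ {k} _ → steps (advance k i)
  ; injective = λ k<12 l<12 ck≡cl → advance-injective i k<12 l<12 (c-inj ck≡cl)
  ; covers    = covers
  }
  where
  covers : ∀ v → ∃[ k ] k < 12 × c (advance k i) ≡ v
  covers v with p , cp≡v ← injective⇒surjective c-inj v
           with k , k<12 , k↦p ← advance-surjective i p
           = k , k<12 , trans (cong c k↦p) cp≡v

v₁v₉-∉-HamiltonCircuit : ∀ {h} → IsHamiltonCircuit h → h v₁v₉ ≡ false
v₁v₉-∉-HamiltonCircuit {h} H@(_ , _ , _ , onCircuit , _) with h v₁v₉ in used
... | false = refl
... | true with i , joins ← onCircuit v₁v₉ used = contradiction v₂∼v₁₂ λ ()
  where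
  same-side : ∀ v → ¬ OneOf v₁ v₉ v → inL v ≡ inL (walkFrom H i 2)
  same-side v = ∉-cover⇒same-side (walkFrom-isHamiltonPath H i) cut-coveredBy-v₁v₉ joins

  v₂∼v₁₂ : inL v₂ ≡ inL v₁₂
  v₂∼v₁₂ = trans (same-side v₂ λ { (inj₁ ()) ; (inj₂ ()) }) (sym (same-side v₁₂ λ { (inj₁ ()) ; (inj₂ ()) }))

sumH-vanishes : ∀ e → (∀ (H : HamiltonCircuit) → proj₁ H e ≡ false) → ∀ hs → sumH hs e ≡ false
sumH-vanishes e avoided []       = refl
sumH-vanishes e avoided (H ∷ hs) = cong₂ _xor_ (avoided H) (sumH-vanishes e avoided hs)

avoided-edge⇒∉HamSpan : ∀ {z} e → (∀ (H : HamiltonCircuit) → proj₁ H e ≡ false) → z e ≡ true → ¬ InHamSpan z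
avoided-edge⇒∉HamSpan e avoided ze≡true (hs , sum≡z)
  with () ← trans (sym ze≡true) (trans (sym (sum≡z e)) (sumH-vanishes e avoided hs))

-- the 4-cycle v₁v₇v₂v₉: edges 0, 4, 6, 2 are v₁v₇, v₂v₇, v₂v₉, v₉v₁
square : Chain
square e = does (e ≟ # 0) ∨ does (e ≟ # 2) ∨ does (e ≟ # 4) ∨ does (e ≟ # 6)

square-isCycle : InCycleSpace square
square-isCycle = toWitness {a? = all? λ v → boundary square v Bool.≟ false} tt

proposition3p2 : Σ Chain (λ z → InCycleSpace z × ¬ InHamSpan z)
proposition3p2 = square , square-isCycle , avoided-edge⇒∉HamSpan v₁v₉ (v₁v₉-∉-HamiltonCircuit ∘ proj₂) refl
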